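{- Let $L_n$ be the lattice of arithmetic progressions in $[n]$ and let $A_n\subseteq L_n$ be its set of coatoms (elements covered by $[n]$). Then $A_1=\{\emptyset\}$, $A_2=\{\{1\},\{2\}\}$, $A_3=\{\{1,2\},\{1,3\},\{2,3\}\}$, and for $n\ge4$, $A_n=B_n\cup C_n$, where $B_n=\{\{1,2,\ldots,n-1\},\{2,3,\ldots,n\}\}$ and $$C_n=\begin{cases}\{\{1,n\}\}, & \text{if } n-1 \text{ is prime};\\ \big\{\{1,1+p,1+2p,\ldots,n\}: p \text{ prime},\ p\mid n-1\big\}, & \text{otherwise}.\end{cases}$$ In particular, for $n\ge4$, $|A_n|=\omega(n-1)+2$, where $\omega(m)$ is the number of distinct prime divisors of $m$.
   Context: $L_n$ is the set of all subsets of $[n]=\{1,\ldots,n\}$ that are arithmetic progressions $\{a,a+r,\ldots,a+(k-1)r\}$ ($a$, $r\ge1$, $k\ge0$ integers; including $\emptyset$, singletons and $2$-element subsets), ordered by inclusion; it is a lattice with minimum $\emptyset$, maximum $[n]$, and meet equal to intersection. -}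

module Defs where

open import Data.Nat using (ℕ; zero; suc; _+_; _*_; _∸_; _≤_; _<_)
open import Data.Nat.Properties using (_≟_)
open import Data.Nat.Divisibility using (_∣_; _∣?_)
open import Data.Nat.Primality using (Prime; prime?)
open import Data.Fin using (Fin; toℕ)
open import Data.Fin.Subset using (Subset; _∈_; _⊆_; ⊤)
open import Data.Vec using (tabulate)
open import Data.List using (List; map; upTo; filter; length)
open import Data.List.Membership.DecPropositional _≟_ using (_∈?_)
open import Data.Product using (Σ; _×_; ∃-syntax)
open import Data.Sum using (_⊎_)
open import Function.Bundles using (_⇔_)
open import Relation.Nullary using (does; ¬_)
open import Relation.Nullary.Decidable using (_×-dec_)
open import Relation.Binary.PropositionalEquality using (_≡_; _≢_)

-- Convention: an element x : Fin n of a Subset n stands for the number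
-- suc (toℕ x) ∈ [n] = {1,…,n}.
num : {n : ℕ} → Fin n → ℕ
num x = suc (toℕ x)

IsAP : (n : ℕ) → Subset n → Set
IsAP n S = Σ ℕ λ a → Σ ℕ λ r → Σ ℕ λ k →
  (1 ≤ a) × (1 ≤ r) × (∀ i → i < k → a + i * r ≤ n) ×
  (∀ (x : Fin n) → (x ∈ S) ⇔ (∃[ i ] (i < k × num x ≡ a + i * r)))

IsCoatom : (n : ℕ) → Subset n → Set
IsCoatom n S = IsAP n S × S ≢ ⊤ ×
  (∀ (T : Subset n) → IsAP n T → S ⊆ T → T ≡ S ⊎ T ≡ ⊤)

fromList : (n : ℕ) → List ℕ → Subset n
fromList n xs = tabulate (λ x → does (num x ∈? xs))

apList : ℕ → ℕ → ℕ → List ℕ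
apList a r k = map (λ i → a + i * r) (upTo k)

-- ω m : number of distinct prime divisors of m (for m ≥ 1 all lie in 0..m).
ω : ℕ → ℕ
ω m = length (filter (λ p → prime? p ×-dec p ∣? m) (upTo (suc m)))

InC : (n : ℕ) → Subset n → Set
InC n S =
  (Prime (n ∸ 1) × S ≡ fromList n (1 Data.List.∷ n Data.List.∷ Data.List.[])) ⊎
  (¬ Prime (n ∸ 1) ×
    (∃[ p ] ∃[ q ] (Prime p × n ∸ 1 ≡ q * p × S ≡ fromList n (apList 1 p (suc q)))))

InB : (n : ℕ) → Subset n → Set
InB n S = S ≡ fromList n (apList 1 1 (n ∸ 1)) ⊎ S ≡ fromList n (apList 2 1 (n ∸ 1))

-- [n] ∖ {1} and [n] ∖ {n} are progressions, so a coatom missing 1 or n is one of them.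
-- A progression containing both ends is 1, 1 + r, …, n with r ∣ n − 1. If it is a coatom,
-- then r ≠ 1, and for a prime p ∣ r it lies inside the progression of step p, hence equals
-- it. Conversely, a progression containing 1, 1 + p and n has a step dividing p, so for p
-- prime it is [n] or the progression of step p. Distinct primes give distinct progressions,
-- which yields the count ω(n − 1) + 2.
module Submission where

open import Defs
open import Data.Bool using (Bool; true)
open import Data.Bool.Properties using (T-≡)
open import Data.Fin using (Fin; zero; suc; toℕ; fromℕ; fromℕ<)
open import Data.Fin.Properties using (toℕ-injective; toℕ<n; toℕ-fromℕ; toℕ-fromℕ<)
  renaming (_≟_ to _≟ᶠ_)
open import Data.Fin.Subset using (Subset; ⊥; ⊤; _∈_; _∉_; _⊆_; ∁; ⁅_⁆; inside; outside)
open import Data.Fin.Subset.Properties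
  using (⊆-antisym; ⊆⊤; ∈⊤; x∈⁅y⁆⇒x≡y; x∈⁅x⁆; x∉⁅y⁆⇒x≢y; x≢y⇒x∉⁅y⁆; x∈p⇒x∉∁p; x∈∁p⇒x∉p;
         x∉p⇒x∈∁p; x∉∁p⇒x∈p)
  renaming (_∈?_ to _∈ˢ?_)
open import Data.Vec using (tabulate; _∷_; [])
open import Data.Vec.Properties using (lookup∘tabulate; []=⇒lookup; lookup⇒[]=)
open import Data.List using (List; _∷_; []; length; map; upTo; filter)
open import Data.List.Properties using (length-map)
open import Data.List.Membership.Propositional using () renaming (_∈_ to _∈ₗ_)
open import Data.List.Membership.Propositional.Properties
  using (∈-map⁺; ∈-map⁻; ∈-upTo⁺; ∈-upTo⁻; ∈-filter⁺; ∈-filter⁻)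
open import Data.List.Relation.Unary.All as All using (All; _∷_; [])
import Data.List.Relation.Unary.All.Properties as All
open import Data.List.Relation.Unary.AllPairs using (_∷_; [])
open import Data.List.Relation.Unary.Any using (here; there)
open import Data.List.Relation.Unary.Unique.Propositional using (Unique)
open import Data.List.Relation.Unary.Unique.Propositional.Properties using (filter⁺; upTo⁺)
open import Data.Nat using (ℕ; NonZero; zero; suc; _+_; _*_; _∸_; _≤_; _<_; s≤s; s≤s⁻¹; z<s;
  >-nonZero; >-nonZero⁻¹)
open import Data.Nat.Properties
  using (_≟_; ≤-refl; <⇒≤; *-comm; ≤-antisym; ≤-<-trans; ≤∧≢⇒<; <-irrefl; m≤m+n; m≤m*n; +-comm;
         +-identityʳ; +-cancelˡ-≡; +-cancelˡ-≤; *-identityʳ; *-identityˡ; *-assoc; *-monoˡ-≤;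
         *-cancelʳ-≡; *-cancelʳ-≤; m*n≡1⇒n≡1; suc-injective)
open import Data.List.Membership.DecPropositional _≟_ using (_∈?_)
open import Data.Nat.Divisibility using (_∣_; divides; _∣?_; ∣⇒≤)
open import Data.Nat.ListAction using (product)
open import Data.Nat.Primality
  using (Prime; prime?; prime[2]; ¬prime[1]; prime⇒irreducible; prime⇒nonZero)
open import Data.Nat.Primality.Factorisation using (factorise)
open import Data.Product using (_×_; _,_; proj₂; ∃-syntax)
open import Data.Sum using (_⊎_; inj₁; inj₂)
open import Function using (_∘_)
open import Function.Bundles using (_⇔_; mk⇔; Equivalence)
open import Function.Properties.Equivalence using () renaming (trans to ⇔-trans; sym to ⇔-sym)
open import Relation.Nullary using (Dec; yes; no; contradiction)
open import Relation.Nullary.Decidable using (dec-true; isYes≗does; toWitness; _×-dec_)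
open import Relation.Binary.PropositionalEquality
  using (_≡_; _≢_; refl; sym; trans; cong; subst; subst₂; module ≡-Reasoning)

open Equivalence using (to; from)

Unique-map⁺ : ∀ {A B : Set} {P : A → Set} {f : A → B} {xs} →
              (∀ {x y} → P x → P y → f x ≡ f y → x ≡ y) → All P xs → Unique xs → Unique (map f xs)
Unique-map⁺ inj [] [] = []
Unique-map⁺ inj (px ∷ pxs) (x∉xs ∷ u) =
  All.map⁺ (All.zipWith (λ { (py , x≢y) fx≡fy → x≢y (inj px py fx≡fy) }) (pxs , x∉xs))
  ∷ Unique-map⁺ inj pxs u

IsTerm : ℕ → ℕ → ℕ → ℕ → Set
IsTerm a r k v = ∃[ i ] (i < k × v ≡ a + i * r)

∈-tabulate⇔ : ∀ {n} {f : Fin n → Bool} {x} → x ∈ tabulate f ⇔ f x ≡ true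
∈-tabulate⇔ {f = f} {x} = mk⇔
  (λ x∈ → trans (sym (lookup∘tabulate f x)) ([]=⇒lookup x∈))
  (λ fx → lookup⇒[]= x (tabulate f) (trans (lookup∘tabulate f x) fx))

∈-fromList⇔ : ∀ {n xs} {x : Fin n} → x ∈ fromList n xs ⇔ num x ∈ₗ xs
∈-fromList⇔ {xs = xs} {x} = ⇔-trans ∈-tabulate⇔ (mk⇔
  (λ does≡true → toWitness (from T-≡ (trans (isYes≗does (num x ∈? xs)) does≡true)))
  (dec-true (num x ∈? xs)))

∈-apList⇔ : ∀ {a r k v} → v ∈ₗ apList a r k ⇔ IsTerm a r k v
∈-apList⇔ {a} {r} = mk⇔
  (λ v∈ → let i , i∈ , v≡ = ∈-map⁻ (λ i → a + i * r) v∈ in i , ∈-upTo⁻ i∈ , v≡)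
  (λ { (i , i<k , refl) → ∈-map⁺ (λ i → a + i * r) (∈-upTo⁺ i<k) })

-- Opaque so that unification recovers n a r k from a goal about progression n a r k:
-- unfolded, fromList n (apList a r k) reduces and its arguments can no longer be inferred.
opaque
  progression : (n a r k : ℕ) → Subset n
  progression n a r k = fromList n (apList a r k)

  progression≡fromList : ∀ {n a r k} → progression n a r k ≡ fromList n (apList a r k)
  progression≡fromList = refl

  ∈-progression⇔ : ∀ {n a r k} {x : Fin n} → x ∈ progression n a r k ⇔ IsTerm a r k (num x)
  ∈-progression⇔ = ⇔-trans ∈-fromList⇔ ∈-apList⇔

∈-progression⁺ : ∀ {n a r k} {x : Fin n} → IsTerm a r k (num x) → x ∈ progression n a r k
∈-progression⁺ = from ∈-progression⇔

∈-progression⁻ : ∀ {n a r k} {x : Fin n} → x ∈ progression n a r k → IsTerm a r k (num x)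
∈-progression⁻ = to ∈-progression⇔

progression-isAP : ∀ {n a r k} → 1 ≤ a → 1 ≤ r → (∀ i → i < k → a + i * r ≤ n) →
                   IsAP n (progression n a r k)
progression-isAP {a = a} {r} {k} 1≤a 1≤r bounded =
  a , r , k , 1≤a , 1≤r , bounded , λ _ → ∈-progression⇔

≡-progression : ∀ {n a r k} {T : Subset n} → (∀ x → x ∈ T ⇔ IsTerm a r k (num x)) →
                T ≡ progression n a r k
≡-progression T⇔ = ⊆-antisym (∈-progression⁺ ∘ to (T⇔ _)) (from (T⇔ _) ∘ ∈-progression⁻)

num≤n : ∀ {n} (x : Fin n) → num x ≤ n
num≤n = toℕ<n

index-≤ : ∀ {a r i j} → 1 ≤ r → a + i * r ≤ a + j * r → i ≤ j
index-≤ {a} {r} {i} {j} 1≤r le = *-cancelʳ-≤ i j r {{>-nonZero 1≤r}} (+-cancelˡ-≤ a _ _ le)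

progression-truncate : ∀ {n a r j k} → 1 ≤ r → n ≡ a + j * r → j < k →
                       progression n a r k ≡ progression n a r (suc j)
progression-truncate {n} {a} {r} {j} {k} 1≤r n≡ j<k = ⊆-antisym shorten lengthen
  where
  shorten : progression n a r k ⊆ progression n a r (suc j)
  shorten {x} x∈ = let i , _ , x≡ = ∈-progression⁻ x∈ in
    ∈-progression⁺ (i , s≤s (index-≤ 1≤r (subst₂ _≤_ x≡ n≡ (num≤n x))) , x≡)
  lengthen : progression n a r (suc j) ⊆ progression n a r k
  lengthen x∈ = let i , i≤j , x≡ = ∈-progression⁻ x∈ in
    ∈-progression⁺ (i , ≤-<-trans (s≤s⁻¹ i≤j) j<k , x≡)

progression-⊆-divisor : ∀ {n a r c p j} → r ≡ c * p →
                        progression n a r (suc j) ⊆ progression n a p (suc (j * c))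
progression-⊆-divisor {a = a} {c = c} {p} refl x∈ = let i , i≤j , x≡ = ∈-progression⁻ x∈ in
  ∈-progression⁺ (i * c , s≤s (*-monoˡ-≤ c (s≤s⁻¹ i≤j)) ,
                  trans x≡ (cong (a +_) (sym (*-assoc i c p))))

IsTerm-step1⇔ : ∀ {a k u} → IsTerm a 1 k (a + u) ⇔ u < k
IsTerm-step1⇔ {a} {k} {u} = mk⇔
  (λ { (i , i<k , eq) → subst (_< k) (sym (trans (+-cancelˡ-≡ a _ _ eq) (*-identityʳ i))) i<k })
  (λ u<k → u , u<k , cong (a +_) (sym (*-identityʳ u)))

∈∁⁅⁆⇔ : ∀ {n} {x y : Fin n} → x ∈ ∁ ⁅ y ⁆ ⇔ x ≢ y
∈∁⁅⁆⇔ = mk⇔ (x∉⁅y⁆⇒x≢y ∘ x∈∁p⇒x∉p) (x∉p⇒x∈∁p ∘ x≢y⇒x∉⁅y⁆)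

y∉∁⁅y⁆ : ∀ {n} {y : Fin n} → y ∉ ∁ ⁅ y ⁆
y∉∁⁅y⁆ {y = y} = x∈p⇒x∉∁p (x∈⁅x⁆ y)

∁⁅⁆-injective : ∀ {n} {x y : Fin n} → ∁ ⁅ x ⁆ ≡ ∁ ⁅ y ⁆ → x ≡ y
∁⁅⁆-injective {y = y} eq = x∈⁅y⁆⇒x≡y y (x∉∁p⇒x∈p (subst (_ ∉_) eq y∉∁⁅y⁆))

∈⇒∁⁅⁆≢ : ∀ {n} {y : Fin n} {S} → y ∈ S → ∁ ⁅ y ⁆ ≢ S
∈⇒∁⁅⁆≢ y∈S eq = y∉∁⁅y⁆ (subst (_ ∈_) (sym eq) y∈S)

∉⇒⊆∁⁅⁆ : ∀ {n} {y : Fin n} {S} → y ∉ S → S ⊆ ∁ ⁅ y ⁆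
∉⇒⊆∁⁅⁆ y∉S {x} x∈S = from ∈∁⁅⁆⇔ λ { refl → y∉S x∈S }

∉⇒≢⊤ : ∀ {n} {y : Fin n} {S} → y ∉ S → S ≢ ⊤
∉⇒≢⊤ y∉S refl = y∉S ∈⊤

∁⁅⁆-covered : ∀ {n} {y : Fin n} {T} → ∁ ⁅ y ⁆ ⊆ T → T ≡ ∁ ⁅ y ⁆ ⊎ T ≡ ⊤
∁⁅⁆-covered {y = y} {T} ∁⊆T with y ∈ˢ? T
... | no y∉T = inj₁ (⊆-antisym (∉⇒⊆∁⁅⁆ y∉T) ∁⊆T)
... | yes y∈T = inj₂ (⊆-antisym ⊆⊤ λ {x} _ → everything x)
  where
  everything : ∀ x → x ∈ T
  everything x with x ≟ᶠ y
  ... | yes refl = y∈T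
  ... | no x≢y = ∁⊆T (from ∈∁⁅⁆⇔ x≢y)

∁⁅⁆-isCoatom : ∀ {n} {y : Fin n} → IsAP n (∁ ⁅ y ⁆) → IsCoatom n (∁ ⁅ y ⁆)
∁⁅⁆-isCoatom ap = ap , ∉⇒≢⊤ y∉∁⁅y⁆ , λ _ _ → ∁⁅⁆-covered

coatom-⊆⇒≡ : ∀ {n} {S T : Subset n} → IsCoatom n S → IsCoatom n T → S ⊆ T → S ≡ T
coatom-⊆⇒≡ (_ , _ , maximal) (apT , T≢⊤ , _) S⊆T with maximal _ apT S⊆T
... | inj₁ T≡S = sym T≡S
... | inj₂ T≡⊤ = contradiction T≡⊤ T≢⊤

∁⁅fromℕ⁆≡progression : ∀ {m} → ∁ ⁅ fromℕ m ⁆ ≡ progression (suc m) 1 1 m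
∁⁅fromℕ⁆≡progression {m} = ⊆-antisym
  (λ x∈ → ∈-progression⁺ (from IsTerm-step1⇔ (<m (to ∈∁⁅⁆⇔ x∈))))
  (λ x∈ → from ∈∁⁅⁆⇔ (≢top (to IsTerm-step1⇔ (∈-progression⁻ x∈))))
  where
  <m : ∀ {x} → x ≢ fromℕ m → toℕ x < m
  <m {x} x≢ = ≤∧≢⇒< (s≤s⁻¹ (toℕ<n x)) λ x≡m → x≢ (toℕ-injective (trans x≡m (sym (toℕ-fromℕ m))))
  ≢top : ∀ {x} → toℕ x < m → x ≢ fromℕ m
  ≢top lt refl = <-irrefl (toℕ-fromℕ m) lt

∁⁅zero⁆≡progression : ∀ {m} → ∁ ⁅ zero ⁆ ≡ progression (suc m) 2 1 m
∁⁅zero⁆≡progression {m} = ⊆-antisym into onto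
  where
  into : ∁ ⁅ zero ⁆ ⊆ progression (suc m) 2 1 m
  into {zero} x∈ = contradiction x∈ y∉∁⁅y⁆
  into {suc z} _ = ∈-progression⁺ (from IsTerm-step1⇔ (toℕ<n z))
  onto : progression (suc m) 2 1 m ⊆ ∁ ⁅ zero ⁆
  onto {zero} x∈ with ∈-progression⁻ x∈
  ... | _ , _ , ()
  onto {suc z} _ = from (∈∁⁅⁆⇔ {y = zero}) λ ()

∁⁅fromℕ⁆-isAP : ∀ {m} → IsAP (suc m) (∁ ⁅ fromℕ m ⁆)
∁⁅fromℕ⁆-isAP {m} = subst (IsAP (suc m)) (sym ∁⁅fromℕ⁆≡progression)
  (progression-isAP z<s z<s λ i i<m → s≤s (subst (_≤ m) (sym (*-identityʳ i)) (<⇒≤ i<m)))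

∁⁅zero⁆-isAP : ∀ {m} → IsAP (suc m) (∁ ⁅ zero ⁆)
∁⁅zero⁆-isAP {m} = subst (IsAP (suc m)) (sym ∁⁅zero⁆≡progression)
  (progression-isAP z<s z<s λ i i<m → s≤s (subst (_< m) (sym (*-identityʳ i)) i<m))

∁⁅fromℕ⁆-isCoatom : ∀ {m} → IsCoatom (suc m) (∁ ⁅ fromℕ m ⁆)
∁⁅fromℕ⁆-isCoatom = ∁⁅⁆-isCoatom ∁⁅fromℕ⁆-isAP

∁⁅zero⁆-isCoatom : ∀ {m} → IsCoatom (suc m) (∁ ⁅ zero ⁆)
∁⁅zero⁆-isCoatom = ∁⁅⁆-isCoatom {y = zero} ∁⁅zero⁆-isAP

zero∈progression : ∀ {m r j} → zero ∈ progression (suc m) 1 r (suc j)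
zero∈progression = ∈-progression⁺ (0 , z<s , refl)

fromℕ∈progression : ∀ {m r j} → m ≡ j * r → fromℕ m ∈ progression (suc m) 1 r (suc j)
fromℕ∈progression {m} m≡jr = ∈-progression⁺ (_ , ≤-refl , cong suc (trans (toℕ-fromℕ m) m≡jr))

term⇒∣ : ∀ {r k v} → IsTerm 1 r k (suc v) → r ∣ v
term⇒∣ (i , _ , eq) = divides i (suc-injective eq)

progression-⊆⇒∣ : ∀ {m p k r k'} → p ≤ m → 1 < k →
                  progression (suc m) 1 p k ⊆ progression (suc m) 1 r k' → r ∣ p
progression-⊆⇒∣ {p = p} p≤m 1<k P⊆R = term⇒∣ (subst (IsTerm 1 _ _) num≡ (∈-progression⁻ (P⊆R
  (∈-progression⁺ (1 , 1<k , trans num≡ (cong suc (sym (*-identityˡ p))))))))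
  where
  num≡ : num (fromℕ< (s≤s p≤m)) ≡ suc p
  num≡ = cong suc (toℕ-fromℕ< (s≤s p≤m))

first-term≡1 : ∀ {a i r} → 1 ≤ a → 1 ≡ a + i * r → a ≡ 1
first-term≡1 {a} {i} {r} 1≤a eq = ≤-antisym (subst (a ≤_) (sym eq) (m≤m+n a (i * r))) 1≤a

isAP-through-ends : ∀ {m} {T : Subset (suc m)} → IsAP (suc m) T → zero ∈ T → fromℕ m ∈ T →
               ∃[ r ] ∃[ j ] (1 ≤ r × m ≡ j * r × T ≡ progression (suc m) 1 r (suc j))
isAP-through-ends {m} (a , r , k , 1≤a , 1≤r , _ , T⇔) 0∈T top∈T
  with to (T⇔ zero) 0∈T
... | i , _ , 1≡a+ir with first-term≡1 {i = i} 1≤a 1≡a+ir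
... | refl with to (T⇔ (fromℕ m)) top∈T
... | j , j<k , top≡ = r , j , 1≤r , suc-injective n≡ , (begin
  _                            ≡⟨ ≡-progression T⇔ ⟩
  progression (suc m) 1 r k       ≡⟨ progression-truncate 1≤r n≡ j<k ⟩
  progression (suc m) 1 r (suc j) ∎)
  where
  open ≡-Reasoning
  n≡ : suc m ≡ 1 + j * r
  n≡ = trans (cong suc (sym (toℕ-fromℕ m))) top≡

progression-1-1≡⊤ : ∀ {m j} → m ≡ j * 1 → progression (suc m) 1 1 (suc j) ≡ ⊤
progression-1-1≡⊤ {j = j} m≡j*1 with trans m≡j*1 (*-identityʳ j)
... | refl = ⊆-antisym ⊆⊤ (λ {x} _ → ∈-progression⁺ (from IsTerm-step1⇔ (toℕ<n x)))

prime>0 : ∀ {p} → Prime p → 0 < p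
prime>0 {p} pp = >-nonZero⁻¹ p {{prime⇒nonZero pp}}

prime≢1 : ∀ {p} → Prime p → p ≢ 1
prime≢1 pp p≡1 = ¬prime[1] (subst Prime p≡1 pp)

prime-divisor : ∀ r → 1 < r → ∃[ p ] ∃[ c ] (Prime p × r ≡ c * p)
prime-divisor (suc zero) (s≤s ())
prime-divisor r@(suc (suc _)) _ with factorise r
... | record { factors = [] ; isFactorisation = () }
... | record { factors = p ∷ ps ; isFactorisation = r≡ ; factorsPrime = pp ∷ _ } =
  p , product ps , pp , trans r≡ (*-comm p (product ps))

fromℕ≢zero : ∀ {m} → 0 < m → fromℕ m ≢ zero
fromℕ≢zero {suc _} _ ()

quotient>0 : ∀ {m q p} → 0 < m → m ≡ q * p → 0 < q
quotient>0 {q = zero} 0<m refl = 0<m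
quotient>0 {q = suc _} _ _ = z<s

PrimeStride : (m : ℕ) → Subset (suc m) → Set
PrimeStride m S = ∃[ p ] ∃[ q ] (Prime p × m ≡ q * p × S ≡ progression (suc m) 1 p (suc q))

prime-stride-of-prime : ∀ {m p q} → Prime m → Prime p → m ≡ q * p → p ≡ m × q ≡ 1
prime-stride-of-prime {q = q} pm pp m≡qp with prime⇒irreducible pm (divides q m≡qp)
... | inj₁ p≡1 = contradiction p≡1 (prime≢1 pp)
... | inj₂ refl =
  refl , *-cancelʳ-≡ q 1 _ {{prime⇒nonZero pp}} (trans (sym m≡qp) (sym (*-identityˡ _)))

PrimeStride⇔ends : ∀ {m S} → Prime m → PrimeStride m S ⇔ S ≡ fromList (suc m) (1 ∷ suc m ∷ [])
PrimeStride⇔ends {m} pm = mk⇔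
  (λ { (p , q , pp , m≡qp , S≡) → ends (prime-stride-of-prime pm pp m≡qp) S≡ })
  (λ S≡ → m , 1 , pm , sym (*-identityˡ m) , trans S≡ (sym progression[1,m,2]))
  where
  progression[1,m,2] : progression (suc m) 1 m 2 ≡ fromList (suc m) (1 ∷ suc m ∷ [])
  progression[1,m,2] =
    trans progression≡fromList (cong (λ v → fromList (suc m) (1 ∷ suc v ∷ [])) (+-identityʳ m))
  ends : ∀ {p q S} → p ≡ m × q ≡ 1 → S ≡ progression (suc m) 1 p (suc q) →
         S ≡ fromList (suc m) (1 ∷ suc m ∷ [])
  ends (refl , refl) S≡ = trans S≡ progression[1,m,2]

PrimeStride⇔InC : ∀ {m S} → PrimeStride m S ⇔ InC (suc m) S
PrimeStride⇔InC {m} = mk⇔ into onto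
  where
  into : ∀ {S} → PrimeStride m S → InC (suc m) S
  into stride with prime? m
  ... | yes pm = inj₁ (pm , to (PrimeStride⇔ends pm) stride)
  ... | no ¬pm = let p , q , pp , m≡qp , S≡ = stride in
    inj₂ (¬pm , p , q , pp , m≡qp , trans S≡ progression≡fromList)
  onto : ∀ {S} → InC (suc m) S → PrimeStride m S
  onto (inj₁ (pm , S≡)) = from (PrimeStride⇔ends pm) S≡
  onto (inj₂ (_ , p , q , pp , m≡qp , S≡)) = p , q , pp , m≡qp , trans S≡ (sym progression≡fromList)

StandardCoatom : (m : ℕ) → Subset (suc m) → Set
StandardCoatom m S = S ≡ ∁ ⁅ fromℕ m ⁆ ⊎ S ≡ ∁ ⁅ zero ⁆ ⊎ PrimeStride m S

primeDivisor? : (m p : ℕ) → Dec (Prime p × p ∣ m)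
primeDivisor? m p = prime? p ×-dec p ∣? m

primeDivisors : ℕ → List ℕ
primeDivisors m = filter (primeDivisor? m) (upTo (suc m))

stride : (m p : ℕ) → Subset (suc m)
stride m p = progression (suc m) 1 p (suc m)

stride≡ : ∀ {m p q} → Prime p → m ≡ q * p → stride m p ≡ progression (suc m) 1 p (suc q)
stride≡ {p = p} {q} pp m≡qp = progression-truncate (prime>0 pp) (cong suc m≡qp)
  (s≤s (subst (q ≤_) (sym m≡qp) (m≤m*n q p {{prime⇒nonZero pp}})))

module _ {m : ℕ} (0<m : 0 < m) where

  instance
    m≢0 : NonZero m
    m≢0 = >-nonZero 0<m

  stride-isCoatom : ∀ {p q} → Prime p → m ≡ q * p →
                    IsCoatom (suc m) (progression (suc m) 1 p (suc q))
  stride-isCoatom {p} {q} pp m≡qp = isAP , ∉⇒≢⊤ two∉ , maximal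
    where
    p∣m : p ∣ m
    p∣m = divides q m≡qp
    isAP : IsAP (suc m) (progression (suc m) 1 p (suc q))
    isAP = progression-isAP z<s (prime>0 pp)
      λ i i≤q → s≤s (subst (i * p ≤_) (sym m≡qp) (*-monoˡ-≤ p (s≤s⁻¹ i≤q)))
    two∉ : fromℕ< (s≤s 0<m) ∉ progression (suc m) 1 p (suc q)
    two∉ two∈ with ∈-progression⁻ two∈
    ... | i , _ , 2≡ = prime≢1 pp (m*n≡1⇒n≡1 i p (suc-injective (trans (sym 2≡) num≡2)))
      where
      num≡2 : num (fromℕ< (s≤s 0<m)) ≡ 2
      num≡2 = cong suc (toℕ-fromℕ< (s≤s 0<m))
    maximal : ∀ T → IsAP (suc m) T → progression (suc m) 1 p (suc q) ⊆ T →
              T ≡ progression (suc m) 1 p (suc q) ⊎ T ≡ ⊤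
    maximal T apT P⊆T
        with isAP-through-ends apT (P⊆T zero∈progression) (P⊆T (fromℕ∈progression m≡qp))
    ... | r , j , _ , m≡jr , refl
        with prime⇒irreducible pp (progression-⊆⇒∣ (∣⇒≤ p∣m) (s≤s (quotient>0 0<m m≡qp)) P⊆T)
    ... | inj₁ refl = inj₂ (progression-1-1≡⊤ m≡jr)
    ... | inj₂ refl = inj₁ (cong (λ j → progression (suc m) 1 p (suc j))
                              (*-cancelʳ-≡ j q p {{prime⇒nonZero pp}} (trans (sym m≡jr) m≡qp)))

  coatom-through-ends⇒PrimeStride : ∀ {S} → IsCoatom (suc m) S → zero ∈ S → fromℕ m ∈ S →
                                    PrimeStride m S
  coatom-through-ends⇒PrimeStride co@(apS , S≢⊤ , _) 0∈S top∈S with isAP-through-ends apS 0∈S top∈S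
  ... | r , j , 1≤r , m≡jr , refl with r ≟ 1
  ... | yes refl = contradiction (progression-1-1≡⊤ m≡jr) S≢⊤
  ... | no r≢1 with prime-divisor r (≤∧≢⇒< 1≤r (r≢1 ∘ sym))
  ... | p , c , pp , r≡cp =
    p , j * c , pp , m≡jc*p , coatom-⊆⇒≡ co (stride-isCoatom pp m≡jc*p) (progression-⊆-divisor r≡cp)
    where
    m≡jc*p : m ≡ j * c * p
    m≡jc*p = trans m≡jr (trans (cong (j *_) r≡cp) (sym (*-assoc j c p)))

  isCoatom⇔StandardCoatom : ∀ {S} → IsCoatom (suc m) S ⇔ StandardCoatom m S
  isCoatom⇔StandardCoatom = mk⇔ classify realise
    where
    classify : ∀ {S} → IsCoatom (suc m) S → StandardCoatom m S
    classify {S} co with fromℕ m ∈ˢ? S | zero ∈ˢ? S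
    ... | no top∉S | _ = inj₁ (coatom-⊆⇒≡ co ∁⁅fromℕ⁆-isCoatom (∉⇒⊆∁⁅⁆ top∉S))
    ... | yes _ | no 0∉S = inj₂ (inj₁ (coatom-⊆⇒≡ co ∁⁅zero⁆-isCoatom (∉⇒⊆∁⁅⁆ 0∉S)))
    ... | yes top∈S | yes 0∈S = inj₂ (inj₂ (coatom-through-ends⇒PrimeStride co 0∈S top∈S))
    realise : ∀ {S} → StandardCoatom m S → IsCoatom (suc m) S
    realise (inj₁ refl) = ∁⁅fromℕ⁆-isCoatom
    realise (inj₂ (inj₁ refl)) = ∁⁅zero⁆-isCoatom
    realise (inj₂ (inj₂ (_ , _ , pp , m≡qp , refl))) = stride-isCoatom pp m≡qp

  ∈-primeDivisors⇔ : ∀ {p} → p ∈ₗ primeDivisors m ⇔ (Prime p × p ∣ m)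
  ∈-primeDivisors⇔ = mk⇔
    (proj₂ ∘ ∈-filter⁻ (primeDivisor? m) {xs = upTo (suc m)})
    (λ { (pp , p∣m) → ∈-filter⁺ (primeDivisor? m) (∈-upTo⁺ (s≤s (∣⇒≤ p∣m))) (pp , p∣m) })

  coatomList : List (Subset (suc m))
  coatomList = ∁ ⁅ fromℕ m ⁆ ∷ ∁ ⁅ zero ⁆ ∷ map (stride m) (primeDivisors m)

  ∈-coatomList⇔ : ∀ {S} → S ∈ₗ coatomList ⇔ StandardCoatom m S
  ∈-coatomList⇔ = mk⇔ into onto
    where
    into : ∀ {S} → S ∈ₗ coatomList → StandardCoatom m S
    into (here S≡) = inj₁ S≡
    into (there (here S≡)) = inj₂ (inj₁ S≡)
    into (there (there S∈)) with ∈-map⁻ (stride m) S∈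
    ... | p , p∈ , refl with to ∈-primeDivisors⇔ p∈
    ... | pp , divides q m≡qp = inj₂ (inj₂ (p , q , pp , m≡qp , stride≡ pp m≡qp))
    onto : ∀ {S} → StandardCoatom m S → S ∈ₗ coatomList
    onto (inj₁ S≡) = here S≡
    onto (inj₂ (inj₁ S≡)) = there (here S≡)
    onto (inj₂ (inj₂ (p , q , pp , m≡qp , refl))) = there (there
      (subst (_∈ₗ _) (stride≡ pp m≡qp)
        (∈-map⁺ (stride m) (from ∈-primeDivisors⇔ (pp , divides q m≡qp)))))

  fromℕ∈stride : ∀ {p} → p ∈ₗ primeDivisors m → fromℕ m ∈ stride m p
  fromℕ∈stride p∈ with to ∈-primeDivisors⇔ p∈
  ... | pp , divides q m≡qp =
    subst (fromℕ m ∈_) (sym (stride≡ pp m≡qp)) (fromℕ∈progression {j = q} m≡qp)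

  stride-injective : ∀ {p p'} → p ∈ₗ primeDivisors m → p' ∈ₗ primeDivisors m →
                     stride m p ≡ stride m p' → p ≡ p'
  stride-injective {p} p∈ p'∈ eq with to ∈-primeDivisors⇔ p∈ | to ∈-primeDivisors⇔ p'∈
  ... | pp , p∣m | pp' , _
      with prime⇒irreducible pp (progression-⊆⇒∣ (∣⇒≤ p∣m) (s≤s 0<m) (λ x∈ → subst (_ ∈_) eq x∈))
  ... | inj₁ p'≡1 = contradiction p'≡1 (prime≢1 pp')
  ... | inj₂ p'≡p = sym p'≡p

  coatomList-unique : Unique coatomList
  coatomList-unique =
    (fromℕ≢zero 0<m ∘ ∁⁅⁆-injective {y = zero} ∷ All.map⁺ (All.tabulate (∈⇒∁⁅⁆≢ ∘ fromℕ∈stride)))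
    ∷ All.map⁺ (All.tabulate λ _ → ∈⇒∁⁅⁆≢ zero∈progression)
    ∷ Unique-map⁺ stride-injective (All.tabulate λ p∈ → p∈)
                  (filter⁺ (primeDivisor? m) (upTo⁺ (suc m)))

  coatoms-enumerated : ∃[ xs ] (Unique xs × (∀ S → IsCoatom (suc m) S ⇔ S ∈ₗ xs) ×
                                 length xs ≡ ω m + 2)
  coatoms-enumerated =
    coatomList ,
    coatomList-unique ,
    (λ _ → ⇔-trans isCoatom⇔StandardCoatom (⇔-sym ∈-coatomList⇔)) ,
    trans (cong (2 +_) (length-map (stride m) (primeDivisors m))) (+-comm 2 (ω m))

  isCoatom⇔InB⊎InC : ∀ S → IsCoatom (suc m) S ⇔ (InB (suc m) S ⊎ InC (suc m) S)
  isCoatom⇔InB⊎InC _ = ⇔-trans isCoatom⇔StandardCoatom (mk⇔ into onto)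
    where
    B₁≡ : ∁ ⁅ fromℕ m ⁆ ≡ fromList (suc m) (apList 1 1 m)
    B₁≡ = trans ∁⁅fromℕ⁆≡progression progression≡fromList
    B₂≡ : ∁ ⁅ zero ⁆ ≡ fromList (suc m) (apList 2 1 m)
    B₂≡ = trans ∁⁅zero⁆≡progression progression≡fromList
    into : ∀ {S} → StandardCoatom m S → InB (suc m) S ⊎ InC (suc m) S
    into (inj₁ S≡) = inj₁ (inj₁ (trans S≡ B₁≡))
    into (inj₂ (inj₁ S≡)) = inj₁ (inj₂ (trans S≡ B₂≡))
    into (inj₂ (inj₂ stride)) = inj₂ (to PrimeStride⇔InC stride)
    onto : ∀ {S} → InB (suc m) S ⊎ InC (suc m) S → StandardCoatom m S
    onto (inj₁ (inj₁ S≡)) = inj₁ (trans S≡ (sym B₁≡))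
    onto (inj₁ (inj₂ S≡)) = inj₂ (inj₁ (trans S≡ (sym B₂≡)))
    onto (inj₂ inC) = inj₂ (inj₂ (from PrimeStride⇔InC inC))

isCoatom[1]⇔ : ∀ (S : Subset 1) → IsCoatom 1 S ⇔ (S ≡ ⊥)
isCoatom[1]⇔ S = mk⇔ (coatom≡⊥ S) λ { refl → ∁⁅zero⁆-isCoatom }
  where
  coatom≡⊥ : ∀ S → IsCoatom 1 S → S ≡ ⊥
  coatom≡⊥ (outside ∷ []) _ = refl
  coatom≡⊥ (inside ∷ []) (_ , S≢⊤ , _) = contradiction refl S≢⊤

isCoatom[2]⇔ : ∀ (S : Subset 2) → IsCoatom 2 S ⇔ (S ≡ fromList 2 (1 ∷ []) ⊎ S ≡ fromList 2 (2 ∷ []))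
isCoatom[2]⇔ _ = ⇔-trans (isCoatom⇔StandardCoatom z<s) (mk⇔
  (λ { (inj₁ S≡) → inj₁ S≡
     ; (inj₂ (inj₁ S≡)) → inj₂ S≡
     ; (inj₂ (inj₂ (p , q , pp , 1≡qp , _))) →
         contradiction (m*n≡1⇒n≡1 q p (sym 1≡qp)) (prime≢1 pp) })
  (λ { (inj₁ S≡) → inj₁ S≡ ; (inj₂ S≡) → inj₂ (inj₁ S≡) }))

isCoatom[3]⇔ : ∀ (S : Subset 3) → IsCoatom 3 S ⇔
  (S ≡ fromList 3 (1 ∷ 2 ∷ []) ⊎ S ≡ fromList 3 (1 ∷ 3 ∷ []) ⊎ S ≡ fromList 3 (2 ∷ 3 ∷ []))
isCoatom[3]⇔ _ = ⇔-trans (isCoatom⇔StandardCoatom z<s) (mk⇔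
  (λ { (inj₁ S≡) → inj₁ S≡
     ; (inj₂ (inj₁ S≡)) → inj₂ (inj₂ S≡)
     ; (inj₂ (inj₂ stride)) → inj₂ (inj₁ (to (PrimeStride⇔ends prime[2]) stride)) })
  (λ { (inj₁ S≡) → inj₁ S≡
     ; (inj₂ (inj₁ S≡)) → inj₂ (inj₂ (from (PrimeStride⇔ends prime[2]) S≡))
     ; (inj₂ (inj₂ S≡)) → inj₂ (inj₁ S≡) }))

lemma5 :
    (∀ (S : Subset 1) → IsCoatom 1 S ⇔ (S ≡ ⊥)) ×
    (∀ (S : Subset 2) → IsCoatom 2 S ⇔ (S ≡ fromList 2 (1 ∷ []) ⊎ S ≡ fromList 2 (2 ∷ []))) ×
    (∀ (S : Subset 3) → IsCoatom 3 S ⇔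
      (S ≡ fromList 3 (1 ∷ 2 ∷ []) ⊎ S ≡ fromList 3 (1 ∷ 3 ∷ []) ⊎ S ≡ fromList 3 (2 ∷ 3 ∷ []))) ×
    (∀ (n : ℕ) → 4 ≤ n → ∀ (S : Subset n) → IsCoatom n S ⇔ (InB n S ⊎ InC n S)) ×
    (∀ (n : ℕ) → 4 ≤ n → ∃[ xs ] (Unique xs × (∀ (S : Subset n) → IsCoatom n S ⇔ (S ∈ₗ xs)) ×
      length xs ≡ ω (n ∸ 1) + 2))
lemma5 =
  isCoatom[1]⇔ , isCoatom[2]⇔ , isCoatom[3]⇔ ,
  (λ { _ (s≤s (s≤s (s≤s (s≤s _)))) → isCoatom⇔InB⊎InC z<s }) ,
  (λ { _ (s≤s (s≤s (s≤s (s≤s _)))) → coatoms-enumerated z<s })
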